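{- Let $k\ge 3$ and let $i$ and $n$ be nonnegative integers. Then $W^{(k)}_n\oplus ki$ is a factor of $W^{(k)}_{n+ki}$.
   Context: Words are over $\mathbb{N}$. Define the morphism $\varphi_k$ by $\varphi_k(ki+j)=(ki)(ki+j+1)$ if $0\le j\le k-2$ and $\varphi_k(ki+j)=(ki+j+1)$ if $j=k-1$; let $W^{(k)}_n=\varphi_k^n(0)$. For a word $U$ and integer $m$, $U\oplus m$ denotes the word obtained by adding $m$ to every digit of $U$. -}

module Defs where

open import Data.Nat using (ℕ; zero; suc; _+_; _*_; _≟_; NonZero)
open import Data.Nat.DivMod using (_/_; _%_)
open import Data.List using (List; []; _∷_; _++_; concatMap; map)
open import Data.Product using (∃₂; _×_)
open import Relation.Binary.PropositionalEquality using (_≡_)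
open import Relation.Nullary using (yes; no)

φ-letter : (k : ℕ) → .{{NonZero k}} → ℕ → List ℕ
φ-letter k a with suc (a % k) ≟ k
... | yes _ = suc a ∷ []
... | no  _ = (k * (a / k)) ∷ suc a ∷ []

φ : (k : ℕ) → .{{NonZero k}} → List ℕ → List ℕ
φ k w = concatMap (φ-letter k) w

φ^ : (k : ℕ) → .{{NonZero k}} → ℕ → List ℕ → List ℕ
φ^ k zero    w = w
φ^ k (suc n) w = φ k (φ^ k n w)

W : (k : ℕ) → .{{NonZero k}} → ℕ → List ℕ
W k n = φ^ k n (0 ∷ [])

_⊕_ : List ℕ → ℕ → List ℕ
U ⊕ m = map (_+ m) U

Factor : List ℕ → List ℕ → Set
Factor U V = ∃₂ λ (x y : List ℕ) → x ++ U ++ y ≡ V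

open import Data.Nat using (_≤_; s≤s)
nonZero-≥3 : {k : ℕ} → 3 ≤ k → NonZero k
nonZero-≥3 (s≤s _) = _

module Submission where

-- The morphism φ_k commutes with adding a multiple of k to every letter, since such a
-- shift preserves both the residue a % k and the block k * (a / k) up to the shift.
-- The letter k*i occurs in W_{k*i} (each letter a ends φ_k(a-1)), so applying φ_k^n,
-- which maps factors to factors, puts φ_k^n(k*i) = W_n ⊕ k*i inside φ_k^n(W_{k*i}) = W_{n+k*i}.

open import Defs
open import Data.Nat using (ℕ; zero; suc; _+_; _*_; _≤_; NonZero; _≟_)
open import Data.Nat.Properties using (*-comm; *-distribˡ-+)
open import Data.Nat.DivMod using (_/_; _%_; [m+kn]%n≡m%n; +-distrib-/-∣ʳ; m*n/n≡m)
open import Data.Nat.Divisibility using (m∣m*n)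
open import Data.List using (List; []; _∷_; _++_; concatMap; map)
open import Data.List.Properties using (++-assoc; ++-identityʳ; concatMap-++; concatMap-map; map-concatMap; concatMap-cong)
open import Data.Product using (_,_)
open import Relation.Binary.PropositionalEquality
open import Relation.Nullary using (yes; no)
open import Data.Empty using (⊥-elim)
open ≡-Reasoning

Factor-trans : ∀ {U V X} → Factor U V → Factor V X → Factor U X
Factor-trans {U} (x , y , refl) (x′ , y′ , refl) = x′ ++ x , y ++ y′ , (begin
  (x′ ++ x) ++ U ++ y ++ y′  ≡⟨ ++-assoc x′ x _ ⟩
  x′ ++ x ++ U ++ y ++ y′    ≡⟨ cong (λ z → x′ ++ x ++ z) (sym (++-assoc U y y′)) ⟩
  x′ ++ x ++ (U ++ y) ++ y′  ≡⟨ cong (x′ ++_) (sym (++-assoc x (U ++ y) y′)) ⟩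
  x′ ++ (x ++ U ++ y) ++ y′  ∎)

concatMap-Factor : ∀ (f : ℕ → List ℕ) {U V} → Factor U V →
                   Factor (concatMap f U) (concatMap f V)
concatMap-Factor f {U} (x , y , refl) = concatMap f x , concatMap f y , sym (begin
  concatMap f (x ++ U ++ y)                        ≡⟨ concatMap-++ f x (U ++ y) ⟩
  concatMap f x ++ concatMap f (U ++ y)            ≡⟨ cong (concatMap f x ++_) (concatMap-++ f U y) ⟩
  concatMap f x ++ concatMap f U ++ concatMap f y  ∎)

concatMap-⊕ : ∀ (f : ℕ → List ℕ) m → (∀ a → f (a + m) ≡ f a ⊕ m) →
              ∀ U → concatMap f (U ⊕ m) ≡ concatMap f U ⊕ m
concatMap-⊕ f m f-⊕ U = begin
  concatMap f (map (_+ m) U)        ≡⟨ concatMap-map f (_+ m) U ⟩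
  concatMap (λ a → f (a + m)) U     ≡⟨ concatMap-cong f-⊕ U ⟩
  concatMap (λ a → f a ⊕ m) U       ≡⟨ map-concatMap (_+ m) f U ⟨
  map (_+ m) (concatMap f U)        ∎

module _ {k : ℕ} .{{_ : NonZero k}} where

  %-+k* : ∀ a i → (a + k * i) % k ≡ a % k
  %-+k* a i = trans (cong (λ c → (a + c) % k) (*-comm k i)) ([m+kn]%n≡m%n a i k)

  k*/-+k* : ∀ a i → k * ((a + k * i) / k) ≡ k * (a / k) + k * i
  k*/-+k* a i = begin
    k * ((a + k * i) / k)    ≡⟨ cong (k *_) (+-distrib-/-∣ʳ a (m∣m*n i)) ⟩
    k * (a / k + k * i / k)  ≡⟨ cong (λ c → k * (a / k + c / k)) (*-comm k i) ⟩
    k * (a / k + i * k / k)  ≡⟨ cong (λ c → k * (a / k + c)) (m*n/n≡m i k) ⟩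
    k * (a / k + i)          ≡⟨ *-distribˡ-+ k (a / k) i ⟩
    k * (a / k) + k * i      ∎

  φ-letter-⊕ : ∀ i a → φ-letter k (a + k * i) ≡ φ-letter k a ⊕ (k * i)
  φ-letter-⊕ i a with suc ((a + k * i) % k) ≟ k | suc (a % k) ≟ k
  ... | yes _    | yes _    = refl
  ... | yes last | no ¬last = ⊥-elim (¬last (trans (cong suc (sym (%-+k* a i))) last))
  ... | no ¬last | yes last = ⊥-elim (¬last (trans (cong suc (%-+k* a i)) last))
  ... | no _     | no _     = cong (λ c → c ∷ suc (a + k * i) ∷ []) (k*/-+k* a i)

  φ^-⊕ : ∀ i n U → φ^ k n (U ⊕ (k * i)) ≡ φ^ k n U ⊕ (k * i)
  φ^-⊕ i zero    U = refl
  φ^-⊕ i (suc n) U = begin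
    φ k (φ^ k n (U ⊕ (k * i)))  ≡⟨ cong (φ k) (φ^-⊕ i n U) ⟩
    φ k (φ^ k n U ⊕ (k * i))    ≡⟨ concatMap-⊕ (φ-letter k) (k * i) (φ-letter-⊕ i) (φ^ k n U) ⟩
    φ k (φ^ k n U) ⊕ (k * i)    ∎

  φ^-Factor : ∀ n {U V} → Factor U V → Factor (φ^ k n U) (φ^ k n V)
  φ^-Factor zero    f = f
  φ^-Factor (suc n) f = concatMap-Factor (φ-letter k) (φ^-Factor n f)

  φ^-+ : ∀ n m U → φ^ k n (φ^ k m U) ≡ φ^ k (n + m) U
  φ^-+ zero    m U = refl
  φ^-+ (suc n) m U = cong (φ k) (φ^-+ n m U)

  suc-Factor-φ : ∀ a → Factor (suc a ∷ []) (φ k (a ∷ []))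
  suc-Factor-φ a rewrite ++-identityʳ (φ-letter k a) with suc (a % k) ≟ k
  ... | yes _ = [] , [] , refl
  ... | no  _ = k * (a / k) ∷ [] , [] , refl

  letter-Factor-W : ∀ a → Factor (a ∷ []) (W k a)
  letter-Factor-W zero    = [] , [] , refl
  letter-Factor-W (suc a) =
    Factor-trans (suc-Factor-φ a) (concatMap-Factor (φ-letter k) (letter-Factor-W a))

  W-⊕-Factor : ∀ i n → Factor (W k n ⊕ (k * i)) (W k (n + k * i))
  W-⊕-Factor i n = subst₂ Factor
    (φ^-⊕ i n (0 ∷ []))
    (φ^-+ n (k * i) (0 ∷ []))
    (φ^-Factor n (letter-Factor-W (k * i)))

corollary4 : (k : ℕ) → (hk : 3 ≤ k) → (i n : ℕ) →
    let instance _ = nonZero-≥3 hk in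
    Factor (W k n ⊕ (k * i)) (W k (n + k * i))
corollary4 k hk i n = let instance _ = nonZero-≥3 hk in W-⊕-Factor i n
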